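{- Let $\ell\ge1$ and $0\le m\le\ell$ be integers. Then $$W(\ell-m,m)=\{\mu^b[1]\;:\;\mu\in\mathcal F_1^m(\Lambda_\ell)\},$$ where partitions differing only by trailing zeros are identified.
   Context: $\Lambda_\ell=(3\ell-2,3\ell-5,\dots,7,4,1)$. $\mathcal F_1^m(\Lambda_\ell)$ is the set of strict partitions obtained by adding $m$ nodes labelled $1$ to $\Lambda_\ell$, where cells of each row are labelled from the left by the repeating pattern $0,1,0$ (column $j$ has label $1$ iff $j\equiv2\pmod3$); concretely it is the set of the $\binom{\ell}{m}$ partitions $\Lambda_\ell+\sum_{i\in I}e_i$, $I\subseteq\{1,\dots,\ell\}$, $|I|=m$ (adding one box at the end of row $i$ for each $i\in I$). 3-quotient: for a partition $\lambda=(\lambda_1,\dots,\lambda_N)$ padded with zeros so that $3\mid N$, let $\xi=\lambda+(N-1,\dots,1,0)$; for $k=0,1,2$ let $\xi^{(k)}$ be the elements of $\{(\xi_i-k)/3:\xi_i\equiv k\pmod 3\}$ in decreasing order, of length $N_k$, and $\lambda[k]=\xi^{(k)}-(N_k-1,\dots,1,0)$. For a strict partition $\lambda=(\lambda_1>\dots>\lambda_l>0)$, $D(\lambda)$ is the partition with Frobenius notation $(\lambda_1,\dots,\lambda_l\mid\lambda_1-1,\dots,\lambda_l-1)$, and $\lambda^b[1]:=D(\lambda)[1]$. $W(n,m)$ is the set of $(n,m)$-balanced partitions: partitions $\lambda=(\lambda_1,\dots,\lambda_{2n})$ (weakly decreasing, nonnegative entries) of $2nm$ with $\lambda_i+\lambda_{2n+1-i}=2m$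 for $1\le i\le n$. -}

module Defs where

open import Data.Nat using (ℕ; zero; suc; _+_; _*_; _∸_; _≤_; _<_; _⊓_; _≤?_; _<?_; _≟_)
open import Data.Nat.ListAction using (sum)
open import Data.Nat.DivMod using (_/_; _%_)
open import Data.Bool using (Bool; true; false; if_then_else_)
open import Data.List using (List; []; _∷_; length; map; filter; upTo; downFrom; zipWith; reverse; replicate; _++_)
open import Data.Vec using (Vec; tabulate; lookup; toList)
open import Data.Fin using (Fin; toℕ; opposite)
open import Data.Fin.Subset using (Subset; ∣_∣)
open import Data.Product using (Σ; _×_; ∃)
open import Relation.Nullary using (does)
open import Relation.Binary.PropositionalEquality using (_≡_)

-- Partitions are lists of naturals (largest part first).

nth : List ℕ → ℕ → ℕ
nth []       _       = 0
nth (x ∷ xs) zero    = x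
nth (x ∷ xs) (suc i) = nth xs i

-- remove trailing zeros (partitions differing by trailing zeros are identified)
dropZeros : List ℕ → List ℕ
dropZeros []       = []
dropZeros (0 ∷ xs) = dropZeros xs
dropZeros (x ∷ xs) = x ∷ xs

strip : List ℕ → List ℕ
strip xs = reverse (dropZeros (reverse xs))

Λ : (ℓ : ℕ) → Vec ℕ ℓ
Λ ℓ = tabulate (λ i → 3 * (ℓ ∸ suc (toℕ i)) + 1)

addNodes : (ℓ : ℕ) → Subset ℓ → Vec ℕ ℓ
addNodes ℓ I = tabulate (λ i → lookup (Λ ℓ) i + (if lookup I i then 1 else 0))

-- Partition with Frobenius notation (a_1,…,a_l | b_1,…,b_l):
-- its diagram consists of cells (i,j) (1-indexed) with
--   i ≤ j ≤ i + a_i  (i ≤ l)   or   j < i ≤ j + b_j  (j ≤ l).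
numRows : List ℕ → ℕ
numRows []       = 0
numRows (b1 ∷ _) = suc b1

frobenius : List ℕ → List ℕ → List ℕ
frobenius a b = map row (upTo nrows)
  where
  l : ℕ
  l = length a
  nrows : ℕ
  nrows = numRows b
  row : ℕ → ℕ
  row r = (if does (r <? l) then nth a r + 1 else 0)
          + length (filter (λ j → r ≤? j + nth b j) (upTo (r ⊓ l)))

D : List ℕ → List ℕ
D λs = frobenius λs (map (λ x → x ∸ 1) λs)

pad : ℕ → List ℕ → List ℕ
pad N xs = xs ++ replicate (N ∸ length xs) 0

-- k-th component of the 3-quotient, computed with N = 3 · length λ (a multiple of 3,
-- at least the length of λ).  ξ = λ + (N-1,…,1,0);
-- ξ^(k) = ((ξ_i - k)/3 : ξ_i ≡ k mod 3) in order (decreasing);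
-- λ[k] = ξ^(k) - (N_k - 1,…,1,0).
quot3 : ℕ → List ℕ → List ℕ
quot3 k λs = zipWith _∸_ s (downFrom (length s))
  where
  N : ℕ
  N = 3 * length λs
  ξ : List ℕ
  ξ = zipWith _+_ (pad N λs) (downFrom N)
  s : List ℕ
  s = map (λ x → (x ∸ k) / 3) (filter (λ x → x % 3 ≟ k) ξ)

bquot1 : List ℕ → List ℕ
bquot1 λs = quot3 1 (D λs)

Balanced : (n m : ℕ) → Vec ℕ (2 * n) → Set
Balanced n m w =
  ((i j : Fin (2 * n)) → toℕ i ≤ toℕ j → lookup w j ≤ lookup w i)
  × (sum (toList w) ≡ 2 * n * m)
  × ((i : Fin (2 * n)) → toℕ i < n → lookup w i + lookup w (opposite i) ≡ 2 * m)

InW : (n m : ℕ) → List ℕ → Set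
InW n m λs = Σ (Vec ℕ (2 * n)) (λ w → Balanced n m w × strip (toList w) ≡ strip λs)

InF : (ℓ m : ℕ) → List ℕ → Set
InF ℓ m λs = Σ (Subset ℓ) (λ I → ∣ I ∣ ≡ m × strip (bquot1 (toList (addNodes ℓ I))) ≡ strip λs)

-- Encode I as the word x ∈ {0,1}^ℓ read from the longest row, so μ = Λ_ℓ + e_I has rows
-- 3(ℓ-1-i) + 1 + x_i.  Putting a row p + 1 on top of a strict partition with parts ≤ p adds a
-- hook to the doubled diagram, D(p+1, μ) = (p+2, D(μ) + 1^p); on β-numbers this inserts one
-- large bead and moves the first p beads up by one.  By induction the β-numbers of D(μ) are
-- N + μ_i, the two beads B + 3i and B + 3i + 1 + x_i for every row i, and all of [0, B).
-- On runner 1 of the 3-abacus every 0 of x leaves one bead of each of the first two kinds;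
-- after removing the staircase they read m + d_j and m - d_j, where d_j counts the 1s after
-- the j-th 0.  So μ^b[1] = (m + d_1, …, m + d_n, m - d_n, …, m - d_1) with n = ℓ - m, d a
-- partition in an n × m box.  Conversely a balanced partition is determined by its first half
-- minus m, which is such a d, and d is traced by exactly one word with m ones.

module Submission where

open import Defs
open import Data.Bool using (Bool; true; false; if_then_else_)
open import Data.List
  using (List; []; _∷_; _++_; _∷ʳ_; length; map; filter; reverse; replicate; zipWith; applyUpTo; upTo; downFrom)
open import Data.List.Properties
  using (∷-injectiveˡ; ∷-injectiveʳ; ++-assoc; ++-identityʳ; length-++; length-map; length-replicate; length-reverse;
         length-applyUpTo; map-++; map-∘; map-cong; map-cong-local; map-applyUpTo; filter-++; filter-accept; filter-reject;
         filter-≐; reverse-++; unfold-reverse; reverse-map)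
open import Data.List.Relation.Binary.Permutation.Propositional.Properties using (↭-reverse)
open import Data.List.Relation.Unary.All as All using (All; []; _∷_)
open import Data.Nat
open import Data.Nat.Properties
open import Data.Nat.DivMod using (_/_; _%_; m*n/n≡m; [m+kn]%n≡m%n)
open import Data.Nat.ListAction using (sum)
open import Data.Nat.ListAction.Properties using (sum-++; sum-↭)
open import Data.Nat.Tactic.RingSolver using (solve-∀)
open import Data.Fin as Fin using (Fin; toℕ; fromℕ<; opposite)
open import Data.Fin.Properties using (toℕ<n; toℕ-fromℕ<; opposite-prop)
open import Data.Fin.Subset using (Subset; ∣_∣)
open import Data.Product using (∃; _×_; _,_)
open import Data.Vec using (Vec; []; _∷_; lookup; toList; fromList)
open import Data.Vec.Properties using (toList∘fromList; length-toList)
open import Function using (_∘_; id)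
open import Relation.Binary.PropositionalEquality
open import Relation.Nullary using (Dec; does; yes; no; contradiction)
open import Relation.Unary using (Pred; Decidable)

bit : Bool → ℕ
bit b = if b then 1 else 0

nth-++ˡ : ∀ xs {ys p} → p < length xs → nth (xs ++ ys) p ≡ nth xs p
nth-++ˡ (x ∷ xs) {p = zero}  _         = refl
nth-++ˡ (x ∷ xs) {p = suc p} (s≤s p<) = nth-++ˡ xs p<

nth-++ʳ : ∀ xs {ys p k} → length xs + k ≡ p → nth (xs ++ ys) p ≡ nth ys k
nth-++ʳ []       refl = refl
nth-++ʳ (x ∷ xs) refl = nth-++ʳ xs refl

nth-map : ∀ (f : ℕ → ℕ) xs {p} → p < length xs → nth (map f xs) p ≡ f (nth xs p)
nth-map f (x ∷ xs) {zero}  _         = refl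
nth-map f (x ∷ xs) {suc p} (s≤s p<) = nth-map f xs p<

nth-reverse : ∀ xs {j k} → j + suc k ≡ length xs → nth (reverse xs) k ≡ nth xs j
nth-reverse []       {j} {k} eq = contradiction eq (m+1+n≢0 j)
nth-reverse (x ∷ xs) {j} {k} eq = begin
  nth (reverse (x ∷ xs)) k      ≡⟨ cong (λ ys → nth ys k) (unfold-reverse x xs) ⟩
  nth (reverse xs ++ x ∷ []) k  ≡⟨ last-or-earlier j eq ⟩
  nth (x ∷ xs) j                ∎
  where
  open ≡-Reasoning
  last-or-earlier : ∀ j → j + suc k ≡ suc (length xs) → nth (reverse xs ++ x ∷ []) k ≡ nth (x ∷ xs) j
  last-or-earlier zero    eq =
    nth-++ʳ (reverse xs) (trans (+-identityʳ _) (trans (length-reverse xs) (sym (suc-injective eq))))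
  last-or-earlier (suc j) eq = trans (nth-++ˡ (reverse xs) k<) (nth-reverse xs (suc-injective eq))
    where
    k< : k < length (reverse xs)
    k< = subst (k <_) (sym (trans (length-reverse xs) (sym (suc-injective eq)))) (m≤n+m (suc k) j)

nth-applyUpTo : ∀ (f : ℕ → ℕ) {n p} → p < n → nth (applyUpTo f n) p ≡ f p
nth-applyUpTo f {suc n} {zero}  _         = refl
nth-applyUpTo f {suc n} {suc p} (s≤s p<) = nth-applyUpTo (f ∘ suc) p<

nth-ext : ∀ xs ys → length xs ≡ length ys → (∀ {p} → p < length xs → nth xs p ≡ nth ys p) → xs ≡ ys
nth-ext []       []       _   _  = refl
nth-ext (x ∷ xs) (y ∷ ys) len eq =
  cong₂ _∷_ (eq z<s) (nth-ext xs ys (suc-injective len) (eq ∘ s≤s))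

applyUpTo-cong : ∀ {A : Set} {f g : ℕ → A} k → (∀ {r} → r < k → f r ≡ g r) → applyUpTo f k ≡ applyUpTo g k
applyUpTo-cong zero    _  = refl
applyUpTo-cong (suc k) eq = cong₂ _∷_ (eq z<s) (applyUpTo-cong k (eq ∘ s≤s))

applyUpTo-vanishing : ∀ {f : ℕ → ℕ} {h p} → h ≤ p → (∀ {r} → h ≤ r → f r ≡ 0) →
                      applyUpTo f p ≡ pad p (applyUpTo f h)
applyUpTo-vanishing {p = zero}  z≤n       _      = refl
applyUpTo-vanishing {p = suc p} z≤n       vanish = cong₂ _∷_ (vanish z≤n) (applyUpTo-vanishing z≤n (λ _ → vanish z≤n))
applyUpTo-vanishing             (s≤s h≤p) vanish = cong (_ ∷_) (applyUpTo-vanishing h≤p (vanish ∘ s≤s))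

filter-map : ∀ {A B : Set} {p} {P : Pred A p} (P? : Decidable P) (f : B → A) xs →
             filter P? (map f xs) ≡ map f (filter (P? ∘ f) xs)
filter-map P? f []       = refl
filter-map P? f (x ∷ xs) with does (P? (f x))
... | true  = cong (f x ∷_) (filter-map P? f xs)
... | false = filter-map P? f xs

reverse-replicate : ∀ {A : Set} K (x : A) → reverse (replicate K x) ≡ replicate K x
reverse-replicate zero    x = refl
reverse-replicate (suc K) x =
  trans (unfold-reverse x (replicate K x)) (trans (cong (_∷ʳ x) (reverse-replicate K x)) (snoc K))
  where
  snoc : ∀ K → replicate K x ∷ʳ x ≡ x ∷ replicate K x
  snoc zero    = refl
  snoc (suc K) = cong (x ∷_) (snoc K)

-- Lattice paths and partitions in a box

trues falses : List Bool → ℕ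
trues []          = 0
trues (true ∷ x)  = suc (trues x)
trues (false ∷ x) = trues x
falses []          = 0
falses (true ∷ x)  = falses x
falses (false ∷ x) = suc (falses x)

truesAfter truesBefore : List Bool → List ℕ
truesAfter []          = []
truesAfter (true ∷ x)  = truesAfter x
truesAfter (false ∷ x) = trues x ∷ truesAfter x
truesBefore []          = []
truesBefore (true ∷ x)  = map suc (truesBefore x)
truesBefore (false ∷ x) = 0 ∷ truesBefore x

length≡trues+falses : ∀ x → length x ≡ trues x + falses x
length≡trues+falses []          = refl
length≡trues+falses (true ∷ x)  = cong suc (length≡trues+falses x)
length≡trues+falses (false ∷ x) = trans (cong suc (length≡trues+falses x)) (sym (+-suc (trues x) (falses x)))

length-truesAfter : ∀ x → length (truesAfter x) ≡ falses x
length-truesAfter []          = refl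
length-truesAfter (true ∷ x)  = length-truesAfter x
length-truesAfter (false ∷ x) = cong suc (length-truesAfter x)

data Descending : ℕ → List ℕ → Set where
  []  : ∀ {m} → Descending m []
  _∷_ : ∀ {m e d} → e ≤ m → Descending e d → Descending m (e ∷ d)

Descending⇒All≤ : ∀ {m d} → Descending m d → All (_≤ m) d
Descending⇒All≤ []         = []
Descending⇒All≤ (e≤m ∷ ds) = e≤m ∷ All.map (λ e′≤e → ≤-trans e′≤e e≤m) (Descending⇒All≤ ds)

Descending-nth≤ : ∀ {m d} → Descending m d → ∀ p → nth d p ≤ m
Descending-nth≤ []         _       = z≤n
Descending-nth≤ (e≤m ∷ ds) zero    = e≤m
Descending-nth≤ (e≤m ∷ ds) (suc p) = ≤-trans (Descending-nth≤ ds p) e≤m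

Descending-nth-mono : ∀ {m d p q} → Descending m d → p ≤ q → nth d q ≤ nth d p
Descending-nth-mono []       _             = z≤n
Descending-nth-mono (_ ∷ _)  (z≤n {zero})  = ≤-refl
Descending-nth-mono (_ ∷ ds) (z≤n {suc q}) = Descending-nth≤ ds q
Descending-nth-mono (_ ∷ ds) (s≤s p≤q)     = Descending-nth-mono ds p≤q

applyUpTo-descending : ∀ {m} f n → (∀ {p q} → p ≤ q → q < n → f q ≤ f p) → (0 < n → f 0 ≤ m) →
                       Descending m (applyUpTo f n)
applyUpTo-descending f zero    _    _    = []
applyUpTo-descending f (suc n) mono head =
  head z<s ∷ applyUpTo-descending (f ∘ suc) n (λ p≤q q<n → mono (s≤s p≤q) (s≤s q<n)) (λ 0<n → mono z≤n (s≤s 0<n))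

truesAfter-descending : ∀ x {m} → trues x ≤ m → Descending m (truesAfter x)
truesAfter-descending []          _  = []
truesAfter-descending (true ∷ x)  le = truesAfter-descending x (≤-trans (n≤1+n _) le)
truesAfter-descending (false ∷ x) le = le ∷ truesAfter-descending x ≤-refl

truesBefore≡ : ∀ x → truesBefore x ≡ map (trues x ∸_) (truesAfter x)
truesBefore≡ []          = refl
truesBefore≡ (false ∷ x) = cong₂ _∷_ (sym (n∸n≡0 (trues x))) (truesBefore≡ x)
truesBefore≡ (true ∷ x)  = begin
  map suc (truesBefore x)                    ≡⟨ cong (map suc) (truesBefore≡ x) ⟩
  map suc (map (trues x ∸_) (truesAfter x))  ≡⟨ map-∘ (truesAfter x) ⟨
  map (suc ∘ (trues x ∸_)) (truesAfter x)    ≡⟨ map-cong-local (All.map (+-∸-assoc 1) bounded) ⟨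
  map (suc (trues x) ∸_) (truesAfter x)      ∎
  where
  open ≡-Reasoning
  bounded : All (_≤ trues x) (truesAfter x)
  bounded = Descending⇒All≤ (truesAfter-descending x ≤-refl)

balancedOf : ℕ → List ℕ → List ℕ
balancedOf m d = map (m +_) d ++ reverse (map (m ∸_) d)

pathOf : ℕ → List ℕ → List Bool
pathOf m []      = replicate m true
pathOf m (e ∷ d) = replicate (m ∸ e) true ++ false ∷ pathOf e d

trues-trueRun : ∀ k x → trues (replicate k true ++ x) ≡ k + trues x
trues-trueRun zero    x = refl
trues-trueRun (suc k) x = cong suc (trues-trueRun k x)

falses-trueRun : ∀ k x → falses (replicate k true ++ x) ≡ falses x
falses-trueRun zero    x = refl
falses-trueRun (suc k) x = falses-trueRun k x

truesAfter-trueRun : ∀ k x → truesAfter (replicate k true ++ x) ≡ truesAfter x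
truesAfter-trueRun zero    x = refl
truesAfter-trueRun (suc k) x = truesAfter-trueRun k x

pathOf-[] : ∀ m → pathOf m [] ≡ replicate m true ++ []
pathOf-[] m = sym (++-identityʳ (replicate m true))

trues-pathOf : ∀ {m d} → Descending m d → trues (pathOf m d) ≡ m
trues-pathOf {m} [] = trans (cong trues (pathOf-[] m)) (trans (trues-trueRun m []) (+-identityʳ m))
trues-pathOf {m} (_∷_ {e = e} e≤m ds) =
  trans (trues-trueRun (m ∸ e) _) (trans (cong (m ∸ e +_) (trues-pathOf ds)) (m∸n+n≡m e≤m))

falses-pathOf : ∀ m d → falses (pathOf m d) ≡ length d
falses-pathOf m []      = trans (cong falses (pathOf-[] m)) (falses-trueRun m [])
falses-pathOf m (e ∷ d) = trans (falses-trueRun (m ∸ e) _) (cong suc (falses-pathOf e d))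

truesAfter-pathOf : ∀ {m d} → Descending m d → truesAfter (pathOf m d) ≡ d
truesAfter-pathOf {m} [] = trans (cong truesAfter (pathOf-[] m)) (truesAfter-trueRun m [])
truesAfter-pathOf {m} (_∷_ {e = e} _ ds) =
  trans (truesAfter-trueRun (m ∸ e) _) (cong₂ _∷_ (trues-pathOf ds) (truesAfter-pathOf ds))

-- The doubled diagram D(μ)

-- `frobenius a b` unfolds to `map (frobeniusRow a b) (upTo (numRows b))`.
frobeniusRow : List ℕ → List ℕ → ℕ → ℕ
frobeniusRow a b r = (if does (r <? length a) then nth a r + 1 else 0)
                   + length (filter (λ j → r ≤? j + nth b j) (upTo (r ⊓ length a)))

private
  shifted-count : ∀ c β r k → length (filter (λ j → suc r ≤? j + nth (c ∷ β) j) (applyUpTo suc k))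
                            ≡ length (filter (λ j → r ≤? j + nth β j) (upTo k))
  shifted-count c β r k = begin
    length (filter P? (applyUpTo suc k))          ≡⟨ cong (length ∘ filter P?) (map-applyUpTo id suc k) ⟨
    length (filter P? (map suc (upTo k)))         ≡⟨ cong length (filter-map P? suc (upTo k)) ⟩
    length (map suc (filter (P? ∘ suc) (upTo k))) ≡⟨ length-map suc (filter (P? ∘ suc) (upTo k)) ⟩
    length (filter (P? ∘ suc) (upTo k))           ≡⟨ cong length (filter-≐ (P? ∘ suc) Q? (s≤s⁻¹ , s≤s) (upTo k)) ⟩
    length (filter Q? (upTo k))                   ∎
    where
    open ≡-Reasoning
    P? = λ j → suc r ≤? j + nth (c ∷ β) j
    Q? = λ j → r ≤? j + nth β j

frobeniusRow-leg : ∀ a α c β {r} → r < c → frobeniusRow (a ∷ α) (c ∷ β) (suc r) ≡ suc (frobeniusRow α β r)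
frobeniusRow-leg a α c β {r} r<c =
  trans (cong (λ cells → arm + length cells) (filter-accept P? {x = 0} {xs = applyUpTo suc k} r<c))
        (trans (cong (λ n → arm + suc n) (shifted-count c β r k)) (+-suc arm _))
  where
  arm = if does (r <? length α) then nth α r + 1 else 0
  k   = r ⊓ length α
  P?  = λ j → suc r ≤? j + nth (c ∷ β) j

frobeniusRow-beyondLeg : ∀ a α c β {r} → c ≤ r → frobeniusRow (a ∷ α) (c ∷ β) (suc r) ≡ frobeniusRow α β r
frobeniusRow-beyondLeg a α c β {r} c≤r =
  trans (cong (λ cells → arm + length cells) (filter-reject P? {x = 0} {xs = applyUpTo suc k} (≤⇒≯ c≤r)))
        (cong (arm +_) (shifted-count c β r k))
  where
  arm = if does (r <? length α) then nth α r + 1 else 0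
  k   = r ⊓ length α
  P?  = λ j → suc r ≤? j + nth (c ∷ β) j

data StrictlyDescending : ℕ → List ℕ → Set where
  []  : ∀ {p} → StrictlyDescending p []
  _∷_ : ∀ {p q μ} → q < p → StrictlyDescending q μ → StrictlyDescending p (suc q ∷ μ)

legs : List ℕ → List ℕ
legs = map (_∸ 1)

doubleRow : List ℕ → ℕ → ℕ
doubleRow μ = frobeniusRow μ (legs μ)

length-D : ∀ μ → length (D μ) ≡ numRows (legs μ)
length-D μ = trans (length-map (doubleRow μ) (upTo (numRows (legs μ)))) (length-applyUpTo id (numRows (legs μ)))

numRows-legs≤ : ∀ {p μ} → StrictlyDescending p μ → numRows (legs μ) ≤ p
numRows-legs≤ []        = z≤n
numRows-legs≤ (q<p ∷ _) = q<p

doubleRow-vanishing : ∀ {p μ r} → StrictlyDescending p μ → numRows (legs μ) ≤ r → doubleRow μ r ≡ 0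
doubleRow-vanishing {r = zero}  [] _ = refl
doubleRow-vanishing {r = suc r} [] _ = refl
doubleRow-vanishing {μ = suc q ∷ μ} (_ ∷ s) (s≤s q≤r) =
  trans (frobeniusRow-beyondLeg (suc q) μ q (legs μ) q≤r) (doubleRow-vanishing s (≤-trans (numRows-legs≤ s) q≤r))

D-∷ : ∀ {p μ} → StrictlyDescending p μ → D (suc p ∷ μ) ≡ suc (suc p) ∷ map suc (pad p (D μ))
D-∷ {p} {μ} s = cong₂ _∷_ (trans (+-identityʳ _) (+-comm (suc p) 1)) (begin
  map (doubleRow (suc p ∷ μ)) (applyUpTo suc p)
    ≡⟨ map-applyUpTo suc _ p ⟩
  applyUpTo (doubleRow (suc p ∷ μ) ∘ suc) p
    ≡⟨ applyUpTo-cong p (frobeniusRow-leg (suc p) μ p (legs μ)) ⟩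
  applyUpTo (suc ∘ doubleRow μ) p
    ≡⟨ map-applyUpTo (doubleRow μ) suc p ⟨
  map suc (applyUpTo (doubleRow μ) p)
    ≡⟨ cong (map suc) (applyUpTo-vanishing (numRows-legs≤ s) (doubleRow-vanishing s)) ⟩
  map suc (pad p (applyUpTo (doubleRow μ) h))
    ≡⟨ cong (map suc ∘ pad p) (map-applyUpTo id (doubleRow μ) h) ⟨
  map suc (pad p (D μ))  ∎)
  where
  open ≡-Reasoning
  h = numRows (legs μ)

-- β-numbers and runner 1 of the 3-abacus

beta : ℕ → List ℕ → List ℕ
beta N λs = zipWith _+_ (pad N λs) (downFrom N)

length-pad : ∀ λs {p} → length λs ≤ p → length (pad p λs) ≡ p
length-pad λs le = trans (length-++ λs) (trans (cong (length λs +_) (length-replicate _)) (m+[n∸m]≡n le))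

pad-pad : ∀ λs {p N} → length λs ≤ p → p ≤ N → pad N (pad p λs) ≡ pad N λs
pad-pad []       {zero}          _         _         = refl
pad-pad []       {suc p} {suc N} _         (s≤s p≤N) = cong (0 ∷_) (pad-pad [] z≤n p≤N)
pad-pad (x ∷ λs) {suc p} {suc N} (s≤s l≤p) (s≤s p≤N) = cong (x ∷_) (pad-pad λs l≤p p≤N)

beta-[] : ∀ N → beta N [] ≡ downFrom N
beta-[] zero    = refl
beta-[] (suc N) = cong (N ∷_) (beta-[] N)

beta-increment : ∀ {N} ys {P Q} → beta N ys ≡ P ++ Q → length P ≡ length ys → beta N (map suc ys) ≡ map suc P ++ Q
beta-increment                []       {[]}    eq _   = eq
beta-increment {zero}         (y ∷ ys) {p ∷ P} () _
beta-increment {suc N}        (y ∷ ys) {p ∷ P} eq len =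
  cong₂ _∷_ (cong suc (∷-injectiveˡ eq)) (beta-increment ys {P} (∷-injectiveʳ eq) (suc-injective len))

beta-D-∷ : ∀ {p μ N P Q} → StrictlyDescending p μ → p ≤ N → beta N (D μ) ≡ P ++ Q → length P ≡ p →
           beta (suc N) (D (suc p ∷ μ)) ≡ (suc (suc p) + N) ∷ map suc P ++ Q
beta-D-∷ {p} {μ} {N} {P} {Q} s p≤N eq len =
  trans (cong (beta (suc N)) (D-∷ s)) (cong (_ ∷_) (beta-increment (pad p (D μ)) {P} {Q} padded-eq padded-len))
  where
  D≤p : length (D μ) ≤ p
  D≤p = ≤-trans (≤-reflexive (length-D μ)) (numRows-legs≤ s)
  padded-eq = trans (cong (λ xs → zipWith _+_ xs (downFrom N)) (pad-pad (D μ) D≤p p≤N)) eq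
  padded-len = trans len (sym (length-pad (D μ) D≤p))

rows : List Bool → List ℕ
rows []      = []
rows (b ∷ x) = suc (3 * length x + bit b) ∷ rows x

length-rows : ∀ x → length (rows x) ≡ length x
length-rows []      = refl
length-rows (b ∷ x) = cong suc (length-rows x)

rows-strict : ∀ x {p} → 3 * length x ≤ p → StrictlyDescending p (rows x)
rows-strict []      _  = []
rows-strict (b ∷ x) le = <-≤-trans (row< b (length x)) le ∷ rows-strict x (m≤m+n _ (bit b))
  where
  bit<3 : ∀ b → bit b < 3
  bit<3 false = z<s
  bit<3 true  = s<s z<s
  row< : ∀ b l → 3 * l + bit b < 3 * suc l
  row< b l = <-≤-trans (+-monoʳ-< (3 * l) (bit<3 b)) (≤-reflexive (trans (+-comm (3 * l) 3) (sym (*-suc 3 l))))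

blockBeads : List Bool → ℕ → List ℕ
blockBeads []      B = []
blockBeads (b ∷ x) B = blockBeads x (3 + B) ++ suc (bit b + B) ∷ B ∷ []

length-blockBeads : ∀ x B → length (blockBeads x B) ≡ 2 * length x
length-blockBeads []      B = refl
length-blockBeads (b ∷ x) B =
  trans (length-++ (blockBeads x (3 + B))) (trans (cong (_+ 2) (length-blockBeads x (3 + B))) (two-more (length x)))
  where
  two-more : ∀ l → 2 * l + 2 ≡ 2 * suc l
  two-more = solve-∀

blockBeads-suc : ∀ x B → map suc (blockBeads x B) ≡ blockBeads x (suc B)
blockBeads-suc []      B = refl
blockBeads-suc (b ∷ x) B =
  trans (map-++ suc (blockBeads x (3 + B)) _)
        (cong₂ _++_ (blockBeads-suc x (3 + B)) (cong (λ n → suc n ∷ suc B ∷ []) (sym (+-suc (bit b) B))))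

private
  three-more : ∀ B l → B + 3 * suc l ≡ suc (suc (suc B) + 3 * l)
  three-more = solve-∀

beta-D-rows : ∀ x {N B} → N ≡ B + 3 * length x →
              beta N (D (rows x)) ≡ map (N +_) (rows x) ++ blockBeads x B ++ downFrom B
beta-D-rows []      {N} {B} eq = trans (beta-[] N) (cong downFrom (trans eq (+-identityʳ B)))
beta-D-rows (b ∷ x) {B = B} eq rewrite trans eq (three-more B (length x)) =
  trans (beta-D-∷ {P = P b} {Q b} (rows-strict x (m≤m+n _ (bit b))) p≤N′ (split b) (length-split b))
        (cong₂ _∷_ (cong suc (+-comm (suc p) N′))
                   (trans (shifted b) (cong (R′ ++_) (sym (++-assoc Bl′ (suc (bit b + B) ∷ B ∷ []) (downFrom B))))))
  where
  open ≡-Reasoning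
  l  = length x
  p  = 3 * l + bit b
  N′ = suc (suc B) + 3 * l
  R  = map (N′ +_) (rows x)
  R′ = map (suc N′ +_) (rows x)
  Bl = blockBeads x (2 + B)
  Bl′ = blockBeads x (3 + B)

  p≤N′ : p ≤ N′
  p≤N′ = ≤-trans (+-monoʳ-≤ (3 * l) (bit≤ b)) (≤-reflexive (+-comm (3 * l) _))
    where
    bit≤ : ∀ b → bit b ≤ suc (suc B)
    bit≤ false = z≤n
    bit≤ true  = s≤s z≤n

  length-R++Bl : length (R ++ Bl) ≡ 3 * l
  length-R++Bl = begin
    length (R ++ Bl)         ≡⟨ length-++ R ⟩
    length R + length Bl     ≡⟨ cong₂ _+_ (trans (length-map _ (rows x)) (length-rows x)) (length-blockBeads x _) ⟩
    l + 2 * l                ≡⟨ solve-∀ ⟩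
    3 * l                    ∎

  P Q : Bool → List ℕ
  P false = R ++ Bl
  P true  = (R ++ Bl) ++ suc B ∷ []
  Q false = downFrom (2 + B)
  Q true  = B ∷ downFrom B

  split : ∀ b → beta N′ (D (rows x)) ≡ P b ++ Q b
  split false = trans (beta-D-rows x refl) (sym (++-assoc R Bl _))
  split true  = trans (beta-D-rows x refl) (sym (trans (++-assoc (R ++ Bl) _ (Q true)) (++-assoc R Bl _)))

  length-split : ∀ b → length (P b) ≡ 3 * l + bit b
  length-split false = trans length-R++Bl (sym (+-identityʳ _))
  length-split true  = trans (length-++ (R ++ Bl)) (cong (_+ 1) length-R++Bl)

  map-suc-R++Bl : map suc (R ++ Bl) ≡ R′ ++ Bl′
  map-suc-R++Bl = trans (map-++ suc R Bl) (cong₂ _++_ (sym (map-∘ (rows x))) (blockBeads-suc x (2 + B)))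

  shifted : ∀ b → map suc (P b) ++ Q b ≡ R′ ++ Bl′ ++ suc (bit b + B) ∷ B ∷ downFrom B
  shifted false = trans (cong (_++ Q false) map-suc-R++Bl) (++-assoc R′ Bl′ _)
  shifted true  = begin
    map suc ((R ++ Bl) ++ suc B ∷ []) ++ Q true  ≡⟨ cong (_++ Q true) (map-++ suc (R ++ Bl) _) ⟩
    (map suc (R ++ Bl) ++ suc (suc B) ∷ []) ++ Q true
                                                 ≡⟨ cong (λ xs → (xs ++ suc (suc B) ∷ []) ++ Q true) map-suc-R++Bl ⟩
    ((R′ ++ Bl′) ++ suc (suc B) ∷ []) ++ Q true  ≡⟨ ++-assoc (R′ ++ Bl′) _ (Q true) ⟩
    (R′ ++ Bl′) ++ suc (suc B) ∷ Q true          ≡⟨ ++-assoc R′ Bl′ _ ⟩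
    R′ ++ Bl′ ++ suc (suc B) ∷ B ∷ downFrom B    ∎

addStaircase subStaircase : List ℕ → List ℕ
addStaircase xs = zipWith _+_ xs (downFrom (length xs))
subStaircase xs = zipWith _∸_ xs (downFrom (length xs))

length-addStaircase : ∀ xs → length (addStaircase xs) ≡ length xs
length-addStaircase []       = refl
length-addStaircase (x ∷ xs) = cong suc (length-addStaircase xs)

subStaircase-addStaircase : ∀ xs → subStaircase (addStaircase xs) ≡ xs
subStaircase-addStaircase []       = refl
subStaircase-addStaircase (x ∷ xs) =
  cong₂ _∷_ (trans (cong (x + length xs ∸_) (length-addStaircase xs)) (m+n∸n≡m x (length xs)))
            (subStaircase-addStaircase xs)

addStaircase-++ : ∀ xs ys → addStaircase (xs ++ ys) ≡ map (length ys +_) (addStaircase xs) ++ addStaircase ys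
addStaircase-++ []       ys = refl
addStaircase-++ (x ∷ xs) ys = cong₂ _∷_ shift (addStaircase-++ xs ys)
  where
  shift : x + length (xs ++ ys) ≡ length ys + (x + length xs)
  shift = trans (cong (x +_) (length-++ xs)) (trans (sym (+-assoc x (length xs) _)) (+-comm _ (length ys)))

addStaircase-map : ∀ c xs → addStaircase (map (c +_) xs) ≡ map (c +_) (addStaircase xs)
addStaircase-map c []       = refl
addStaircase-map c (x ∷ xs) =
  cong₂ _∷_ (trans (cong (c + x +_) (length-map (c +_) xs)) (+-assoc c x (length xs))) (addStaircase-map c xs)

addStaircase-replicate : ∀ K → addStaircase (replicate K 0) ≡ downFrom K
addStaircase-replicate zero    = refl
addStaircase-replicate (suc K) = cong₂ _∷_ (length-replicate K) (addStaircase-replicate K)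

onRunner1? : (x : ℕ) → Dec (x % 3 ≡ 1)
onRunner1? x = x % 3 ≟ 1

residue1 : List ℕ → List ℕ
residue1 xs = map (λ x → (x ∸ 1) / 3) (filter onRunner1? xs)

residue1-++ : ∀ xs ys → residue1 (xs ++ ys) ≡ residue1 xs ++ residue1 ys
residue1-++ xs ys = trans (cong (map _) (filter-++ onRunner1? xs ys)) (map-++ _ (filter onRunner1? xs) _)

residue1-∷-0 : ∀ q xs → residue1 (q * 3 ∷ xs) ≡ residue1 xs
residue1-∷-0 q xs =
  cong (map _) (filter-reject onRunner1? {q * 3} {xs} (λ eq → 0≢1+n (trans (sym ([m+kn]%n≡m%n 0 q 3)) eq)))

residue1-∷-1 : ∀ q xs → residue1 (suc (q * 3) ∷ xs) ≡ q ∷ residue1 xs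
residue1-∷-1 q xs = trans (cong (map _) (filter-accept onRunner1? {suc (q * 3)} {xs} ([m+kn]%n≡m%n 1 q 3)))
                          (cong (_∷ residue1 xs) (m*n/n≡m q 3))

residue1-∷-2 : ∀ q xs → residue1 (2 + q * 3 ∷ xs) ≡ residue1 xs
residue1-∷-2 q xs = cong (map _) (filter-reject onRunner1? {2 + q * 3} {xs}
                                   (λ eq → 1+n≢0 (suc-injective (trans (sym ([m+kn]%n≡m%n 2 q 3)) eq))))

residue1-downFrom : ∀ K → residue1 (downFrom (K * 3)) ≡ downFrom K
residue1-downFrom zero    = refl
residue1-downFrom (suc K) =
  trans (residue1-∷-2 K _) (trans (residue1-∷-1 K _) (cong (K ∷_) (trans (residue1-∷-0 K _) (residue1-downFrom K))))

residue1-rows : ∀ A x → residue1 (map (3 * A +_) (rows x)) ≡ map (A +_) (addStaircase (truesAfter x))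
residue1-rows A []          = refl
residue1-rows A (true ∷ x)  =
  trans (cong (λ r → residue1 (r ∷ map (3 * A +_) (rows x))) (on-runner2 A (length x)))
        (trans (residue1-∷-2 (A + length x) _) (residue1-rows A x))
  where
  on-runner2 : ∀ A l → 3 * A + suc (3 * l + 1) ≡ 2 + (A + l) * 3
  on-runner2 = solve-∀
residue1-rows A (false ∷ x) =
  trans (cong (λ r → residue1 (r ∷ map (3 * A +_) (rows x))) (on-runner1 A (length x)))
        (trans (residue1-∷-1 (A + length x) _) (cong₂ _∷_ (cong (A +_) length-x) (residue1-rows A x)))
  where
  on-runner1 : ∀ A l → 3 * A + suc (3 * l + 0) ≡ suc ((A + l) * 3)
  on-runner1 = solve-∀
  length-x : length x ≡ trues x + length (truesAfter x)
  length-x = trans (length≡trues+falses x) (cong (trues x +_) (sym (length-truesAfter x)))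

private
  map-suc-+ : ∀ K ys → map (suc K +_) ys ≡ map (K +_) (map suc ys)
  map-suc-+ K ys = trans (map-cong (λ y → sym (+-suc K y)) ys) (map-∘ ys)

residue1-blockBeads : ∀ x K → residue1 (blockBeads x (K * 3)) ≡ map (K +_) (addStaircase (reverse (truesBefore x)))
residue1-blockBeads []          K = refl
residue1-blockBeads (true ∷ x)  K = begin
  residue1 (blockBeads x (suc K * 3) ++ 2 + K * 3 ∷ K * 3 ∷ [])
    ≡⟨ residue1-++ (blockBeads x (suc K * 3)) _ ⟩
  residue1 (blockBeads x (suc K * 3)) ++ residue1 (2 + K * 3 ∷ K * 3 ∷ [])
    ≡⟨ cong₂ _++_ (residue1-blockBeads x (suc K)) (trans (residue1-∷-2 K _) (residue1-∷-0 K [])) ⟩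
  map (suc K +_) (addStaircase zs) ++ []
    ≡⟨ ++-identityʳ _ ⟩
  map (suc K +_) (addStaircase zs)
    ≡⟨ map-suc-+ K (addStaircase zs) ⟩
  map (K +_) (map suc (addStaircase zs))
    ≡⟨ cong (map (K +_)) (addStaircase-map 1 zs) ⟨
  map (K +_) (addStaircase (map suc zs))
    ≡⟨ cong (map (K +_) ∘ addStaircase) (reverse-map suc (truesBefore x)) ⟩
  map (K +_) (addStaircase (reverse (map suc (truesBefore x))))  ∎
  where
  open ≡-Reasoning
  zs = reverse (truesBefore x)
residue1-blockBeads (false ∷ x) K = begin
  residue1 (blockBeads x (suc K * 3) ++ suc (K * 3) ∷ K * 3 ∷ [])
    ≡⟨ residue1-++ (blockBeads x (suc K * 3)) _ ⟩
  residue1 (blockBeads x (suc K * 3)) ++ residue1 (suc (K * 3) ∷ K * 3 ∷ [])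
    ≡⟨ cong₂ _++_ (residue1-blockBeads x (suc K)) (trans (residue1-∷-1 K _) (cong (K ∷_) (residue1-∷-0 K []))) ⟩
  map (suc K +_) (addStaircase zs) ++ K ∷ []
    ≡⟨ cong₂ (λ ys k → ys ++ k ∷ []) (map-suc-+ K (addStaircase zs)) (sym (+-identityʳ K)) ⟩
  map (K +_) (map suc (addStaircase zs)) ++ K + 0 ∷ []
    ≡⟨ map-++ (K +_) (map suc (addStaircase zs)) (0 ∷ []) ⟨
  map (K +_) (map suc (addStaircase zs) ++ 0 ∷ [])
    ≡⟨ cong (map (K +_)) (addStaircase-++ zs (0 ∷ [])) ⟨
  map (K +_) (addStaircase (zs ++ 0 ∷ []))
    ≡⟨ cong (map (K +_) ∘ addStaircase) (unfold-reverse 0 (truesBefore x)) ⟨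
  map (K +_) (addStaircase (reverse (0 ∷ truesBefore x)))  ∎
  where
  open ≡-Reasoning
  zs = reverse (truesBefore x)

addStaircase-balancedOf : ∀ x K →
  addStaircase (balancedOf (trues x) (truesAfter x) ++ replicate K 0)
  ≡ map ((K + length x) +_) (addStaircase (truesAfter x))
    ++ map (K +_) (addStaircase (reverse (truesBefore x))) ++ downFrom K
addStaircase-balancedOf x K = begin
  addStaircase ((map (t +_) d ++ lower) ++ zeros)
    ≡⟨ cong addStaircase (++-assoc (map (t +_) d) lower zeros) ⟩
  addStaircase (map (t +_) d ++ lower ++ zeros)
    ≡⟨ addStaircase-++ (map (t +_) d) (lower ++ zeros) ⟩
  map (length (lower ++ zeros) +_) (addStaircase (map (t +_) d)) ++ addStaircase (lower ++ zeros)
    ≡⟨ cong₂ _++_ upper-beads (addStaircase-++ lower zeros) ⟩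
  map ((K + length x) +_) (addStaircase d) ++ map (length zeros +_) (addStaircase lower) ++ addStaircase zeros
    ≡⟨ cong₂ (λ k ys → map ((K + length x) +_) (addStaircase d) ++ map (k +_) (addStaircase ys) ++ addStaircase zeros)
             (length-replicate K) (cong reverse (sym (truesBefore≡ x))) ⟩
  map ((K + length x) +_) (addStaircase d) ++ lower-beads ++ addStaircase zeros
    ≡⟨ cong (λ ys → map ((K + length x) +_) (addStaircase d) ++ lower-beads ++ ys) (addStaircase-replicate K) ⟩
  map ((K + length x) +_) (addStaircase d) ++ lower-beads ++ downFrom K  ∎
  where
  open ≡-Reasoning
  t = trues x
  d = truesAfter x
  lower = reverse (map (t ∸_) d)
  zeros = replicate K 0
  lower-beads = map (K +_) (addStaircase (reverse (truesBefore x)))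
  length-lower++zeros : length (lower ++ zeros) ≡ falses x + K
  length-lower++zeros = trans (length-++ lower)
    (cong₂ _+_ (trans (length-reverse (map (t ∸_) d)) (trans (length-map (t ∸_) d) (length-truesAfter x)))
               (length-replicate K))
  rearrange : ∀ f K t z → (f + K) + (t + z) ≡ (K + (t + f)) + z
  rearrange = solve-∀
  upper-beads : map (length (lower ++ zeros) +_) (addStaircase (map (t +_) d))
              ≡ map ((K + length x) +_) (addStaircase d)
  upper-beads = begin
    map (length (lower ++ zeros) +_) (addStaircase (map (t +_) d)) ≡⟨ cong (map _) (addStaircase-map t d) ⟩
    map (length (lower ++ zeros) +_) (map (t +_) (addStaircase d)) ≡⟨ map-∘ (addStaircase d) ⟨
    map (λ z → length (lower ++ zeros) + (t + z)) (addStaircase d)  ≡⟨ map-cong shift (addStaircase d) ⟩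
    map ((K + length x) +_) (addStaircase d)                        ∎
    where
    shift : ∀ z → length (lower ++ zeros) + (t + z) ≡ (K + length x) + z
    shift z = trans (cong (_+ (t + z)) length-lower++zeros)
                    (trans (rearrange (falses x) K t z) (cong (λ l → (K + l) + z) (sym (length≡trues+falses x))))

strip-++-zeros : ∀ xs K → strip (xs ++ replicate K 0) ≡ strip xs
strip-++-zeros xs K = cong reverse (begin
  dropZeros (reverse (xs ++ replicate K 0))
    ≡⟨ cong dropZeros (reverse-++ xs (replicate K 0)) ⟩
  dropZeros (reverse (replicate K 0) ++ reverse xs)
    ≡⟨ cong (λ zs → dropZeros (zs ++ reverse xs)) (reverse-replicate K 0) ⟩
  dropZeros (replicate K 0 ++ reverse xs)
    ≡⟨ dropZeros-zeros K ⟩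
  dropZeros (reverse xs)  ∎)
  where
  open ≡-Reasoning
  dropZeros-zeros : ∀ K → dropZeros (replicate K 0 ++ reverse xs) ≡ dropZeros (reverse xs)
  dropZeros-zeros zero    = refl
  dropZeros-zeros (suc K) = dropZeros-zeros K

quot3-rows : ∀ x {K} → length (D (rows x)) ≡ K + length x →
             quot3 1 (D (rows x)) ≡ balancedOf (trues x) (truesAfter x) ++ replicate K 0
-- `quot3 1 λ` unfolds to `subStaircase (residue1 (beta (3 * length λ) λ))`.
quot3-rows x {K} lenD = begin
  subStaircase (residue1 (beta (3 * L) (D (rows x))))
    ≡⟨ cong (subStaircase ∘ residue1) (beta-D-rows x lowest-bead) ⟩
  subStaircase (residue1 (map (3 * L +_) (rows x) ++ blockBeads x (K * 3) ++ downFrom (K * 3)))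
    ≡⟨ cong subStaircase runner1 ⟩
  subStaircase (map ((K + length x) +_) (addStaircase (truesAfter x))
                ++ map (K +_) (addStaircase (reverse (truesBefore x))) ++ downFrom K)
    ≡⟨ cong subStaircase (addStaircase-balancedOf x K) ⟨
  subStaircase (addStaircase (balancedOf (trues x) (truesAfter x) ++ replicate K 0))
    ≡⟨ subStaircase-addStaircase _ ⟩
  balancedOf (trues x) (truesAfter x) ++ replicate K 0  ∎
  where
  open ≡-Reasoning
  L = length (D (rows x))
  lowest-bead : 3 * L ≡ K * 3 + 3 * length x
  lowest-bead = trans (cong (3 *_) lenD) (distrib K (length x))
    where
    distrib : ∀ K l → 3 * (K + l) ≡ K * 3 + 3 * l
    distrib = solve-∀
  runner1 : residue1 (map (3 * L +_) (rows x) ++ blockBeads x (K * 3) ++ downFrom (K * 3))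
            ≡ map ((K + length x) +_) (addStaircase (truesAfter x))
              ++ map (K +_) (addStaircase (reverse (truesBefore x))) ++ downFrom K
  runner1 = trans (residue1-++ (map (3 * L +_) (rows x)) _)
    (cong₂ _++_ (trans (residue1-rows L x) (cong (λ A → map (A +_) (addStaircase (truesAfter x))) lenD))
                (trans (residue1-++ (blockBeads x (K * 3)) _)
                       (cong₂ _++_ (residue1-blockBeads x K) (residue1-downFrom K))))

length-D-rows : ∀ x → ∃ λ K → length (D (rows x)) ≡ K + length x
length-D-rows []      = 0 , refl
length-D-rows (b ∷ x) = 2 * length x + bit b , trans (length-D (rows (b ∷ x))) (split (length x) (bit b))
  where
  split : ∀ l c → suc (3 * l + c) ≡ (2 * l + c) + suc l
  split = solve-∀

strip-bquot1-rows : ∀ x → strip (bquot1 (rows x)) ≡ strip (balancedOf (trues x) (truesAfter x))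
strip-bquot1-rows x with length-D-rows x
... | K , lenD = trans (cong strip (quot3-rows x lenD)) (strip-++-zeros (balancedOf (trues x) (truesAfter x)) K)

-- Balanced partitions

lower-index< : ∀ {j k n} → j + suc k ≡ n → j < n
lower-index< {j} {k} jk = ≤-trans (s≤s (m≤m+n j k)) (≤-reflexive (trans (sym (+-suc j k)) jk))

lower-offset< : ∀ {j k n} → j + suc k ≡ n → k < n
lower-offset< {j} {k} jk = ≤-trans (m≤n+m (suc k) j) (≤-reflexive jk)

complement-index : ∀ {p n} → p < n → p + suc (n ∸ suc p) ≡ n
complement-index {p} p<n = trans (+-suc p _) (m+[n∸m]≡n p<n)

-- In a list of length 2n, positions j and n + k with j + 1 + k = n are mirror images.
data Half (n : ℕ) : ℕ → Set where
  upper : ∀ {p} → p < n → Half n p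
  lower : ∀ {j k} → j + suc k ≡ n → Half n (n + k)

half : ∀ n {p} → p < 2 * n → Half n p
half n {p} p<2n with p <? n
... | yes p<n = upper p<n
... | no p≮n with m≤n⇒∃[o]m+o≡n (≮⇒≥ p≮n)
...   | k , refl with m≤n⇒∃[o]m+o≡n (+-cancelˡ-< n k n (<-≤-trans p<2n (≤-reflexive (cong (n +_) (+-identityʳ n)))))
...     | j , eq = lower (trans (+-comm j (suc k)) eq)

nth-balancedOf-upper : ∀ m d {p} → p < length d → nth (balancedOf m d) p ≡ m + nth d p
nth-balancedOf-upper m d {p} p< =
  trans (nth-++ˡ (map (m +_) d) (subst (p <_) (sym (length-map (m +_) d)) p<)) (nth-map (m +_) d p<)

nth-balancedOf-lower : ∀ m d {j k} → j + suc k ≡ length d → nth (balancedOf m d) (length d + k) ≡ m ∸ nth d j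
nth-balancedOf-lower m d {j} {k} jk =
  trans (nth-++ʳ (map (m +_) d) (cong (_+ k) (length-map (m +_) d)))
        (trans (nth-reverse (map (m ∸_) d) (trans jk (sym (length-map (m ∸_) d)))) (nth-map (m ∸_) d (lower-index< jk)))

record IsBalanced (n m : ℕ) (L : List ℕ) : Set where
  field
    length≡       : length L ≡ 2 * n
    decreasing    : ∀ {p q} → p ≤ q → q < 2 * n → nth L q ≤ nth L p
    complementary : ∀ {j k} → j + suc k ≡ n → nth L j + nth L (n + k) ≡ 2 * m

private
  +-∸-complement : ∀ {e m} → e ≤ m → (m + e) + (m ∸ e) ≡ 2 * m
  +-∸-complement {e} {m} e≤m =
    trans (+-assoc m e (m ∸ e)) (trans (cong (m +_) (m+[n∸m]≡n e≤m)) (cong (m +_) (sym (+-identityʳ m))))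

balancedOf-isBalanced : ∀ {m d} → Descending m d → IsBalanced (length d) m (balancedOf m d)
balancedOf-isBalanced {m} {d} ds = record
  { length≡       = trans (length-++ (map (m +_) d))
                          (cong₂ _+_ (length-map (m +_) d)
                                     (trans (length-reverse (map (m ∸_) d)) (trans (length-map (m ∸_) d) (sym (+-identityʳ _)))))
  ; decreasing    = decreasing
  ; complementary = λ {j} jk →
      trans (cong₂ _+_ (nth-balancedOf-upper m d (lower-index< jk)) (nth-balancedOf-lower m d jk))
            (+-∸-complement (Descending-nth≤ ds j))
  }
  where
  n = length d
  B = balancedOf m d
  lower≤m : ∀ {j k} → j + suc k ≡ n → nth B (n + k) ≤ m
  lower≤m {j} jk = subst (_≤ m) (sym (nth-balancedOf-lower m d jk)) (m∸n≤m m (nth d j))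
  decreasing : ∀ {p q} → p ≤ q → q < 2 * n → nth B q ≤ nth B p
  decreasing {p} {q} p≤q q<2n with half n (≤-<-trans p≤q q<2n) | half n q<2n
  ... | upper p<n | upper q<n = begin
    nth B q      ≡⟨ nth-balancedOf-upper m d q<n ⟩
    m + nth d q  ≤⟨ +-monoʳ-≤ m (Descending-nth-mono ds p≤q) ⟩
    m + nth d p  ≡⟨ nth-balancedOf-upper m d p<n ⟨
    nth B p      ∎
    where open ≤-Reasoning
  ... | upper p<n | lower jk =
    ≤-trans (lower≤m jk) (≤-trans (m≤m+n m _) (≤-reflexive (sym (nth-balancedOf-upper m d p<n))))
  ... | lower {k = k} _ | upper q<n = contradiction (≤-trans (m≤m+n n k) p≤q) (<⇒≱ q<n)
  ... | lower {j} {k} jk | lower {j′} {k′} jk′ = begin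
    nth B (n + k′)  ≡⟨ nth-balancedOf-lower m d jk′ ⟩
    m ∸ nth d j′    ≤⟨ ∸-monoʳ-≤ m (Descending-nth-mono ds j′≤j) ⟩
    m ∸ nth d j     ≡⟨ nth-balancedOf-lower m d jk ⟨
    nth B (n + k)   ∎
    where
    open ≤-Reasoning
    j′≤j : j′ ≤ j
    j′≤j = +-cancelʳ-≤ (suc k′) j′ j
             (≤-trans (≤-reflexive (trans jk′ (sym jk))) (+-monoʳ-≤ j (s≤s (+-cancelˡ-≤ n k k′ p≤q))))

sum-balancedOf : ∀ {m d} → Descending m d → sum (balancedOf m d) ≡ 2 * length d * m
sum-balancedOf {m} {d} ds = begin
  sum (map (m +_) d ++ reverse (map (m ∸_) d))       ≡⟨ sum-++ (map (m +_) d) _ ⟩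
  sum (map (m +_) d) + sum (reverse (map (m ∸_) d))  ≡⟨ cong (sum (map (m +_) d) +_) (sum-↭ (↭-reverse (map (m ∸_) d))) ⟩
  sum (map (m +_) d) + sum (map (m ∸_) d)            ≡⟨ pairs (Descending⇒All≤ ds) ⟩
  length d * (2 * m)                                 ≡⟨ reassociate (length d) m ⟩
  2 * length d * m                                   ∎
  where
  open ≡-Reasoning
  reassociate : ∀ n m → n * (2 * m) ≡ 2 * n * m
  reassociate = solve-∀
  swap-middle : ∀ a b c e → (a + b) + (c + e) ≡ (a + c) + (b + e)
  swap-middle = solve-∀
  pairs : ∀ {d} → All (_≤ m) d → sum (map (m +_) d) + sum (map (m ∸_) d) ≡ length d * (2 * m)
  pairs []           = refl
  pairs {e ∷ _} (e≤m ∷ es) =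
    trans (swap-middle (m + e) _ (m ∸ e) _) (cong₂ _+_ (+-∸-complement e≤m) (pairs es))

module _ {n m L} (bal : IsBalanced n m L) where
  open IsBalanced bal

  private
    lower<2n : ∀ {j k} → j + suc k ≡ n → n + k < 2 * n
    lower<2n jk = +-monoʳ-< n (≤-trans (lower-offset< jk) (≤-reflexive (sym (+-identityʳ _))))

    upper≥ : ∀ {j k} → j + suc k ≡ n → m ≤ nth L j
    upper≥ {j} {k} jk = *-cancelˡ-≤ 2 (begin
      2 * m                        ≡⟨ complementary jk ⟨
      nth L j + nth L (n + k)      ≤⟨ +-monoʳ-≤ (nth L j) (decreasing j≤n+k (lower<2n jk)) ⟩
      nth L j + nth L j            ≡⟨ cong (nth L j +_) (+-identityʳ _) ⟨
      2 * nth L j                  ∎)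
      where
      open ≤-Reasoning
      j≤n+k = ≤-trans (<⇒≤ (lower-index< jk)) (m≤m+n n k)

    upper≤ : ∀ {j k} → j + suc k ≡ n → nth L j ≤ 2 * m
    upper≤ jk = ≤-trans (m≤m+n _ _) (≤-reflexive (complementary jk))

    lower≡ : ∀ {j k} → j + suc k ≡ n → nth L (n + k) ≡ m ∸ (nth L j ∸ m)
    lower≡ {j} {k} jk = begin
      nth L (n + k)                    ≡⟨ m+n∸m≡n c (nth L (n + k)) ⟨
      c + nth L (n + k) ∸ c            ≡⟨ cong (_∸ c) (+-cancelˡ-≡ m _ _ sum≡) ⟩
      m + 0 ∸ c                        ≡⟨ cong (_∸ c) (+-identityʳ m) ⟩
      m ∸ c                            ∎
      where
      open ≡-Reasoning
      c = nth L j ∸ m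
      sum≡ : m + (c + nth L (n + k)) ≡ m + (m + 0)
      sum≡ = trans (sym (+-assoc m c _)) (trans (cong (_+ nth L (n + k)) (m+[n∸m]≡n (upper≥ jk))) (complementary jk))

  upperHalf : List ℕ
  upperHalf = applyUpTo (λ p → nth L p ∸ m) n

  upperHalf-descending : Descending m upperHalf
  upperHalf-descending = applyUpTo-descending _ n
    (λ p≤q q<n → ∸-monoˡ-≤ m (decreasing p≤q (≤-trans q<n (m≤m+n n _))))
    (λ 0<n → bound (upper≤ (complement-index 0<n)))
    where
    bound : ∀ {a} → a ≤ 2 * m → a ∸ m ≤ m
    bound {a} a≤ = ≤-trans (∸-monoˡ-≤ m a≤) (≤-reflexive (trans (m+n∸m≡n m (m + 0)) (+-identityʳ m)))

  length-upperHalf : length upperHalf ≡ n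
  length-upperHalf = length-applyUpTo _ n

  IsBalanced⇒balancedOf : L ≡ balancedOf m upperHalf
  IsBalanced⇒balancedOf = nth-ext L (balancedOf m upperHalf)
    (trans length≡ (sym (trans (IsBalanced.length≡ (balancedOf-isBalanced upperHalf-descending))
                                (cong (2 *_) length-upperHalf))))
    entry
    where
    entry : ∀ {p} → p < length L → nth L p ≡ nth (balancedOf m upperHalf) p
    entry p< with half n (subst (_ <_) length≡ p<)
    ... | upper {p} p<n = sym (begin
      nth (balancedOf m upperHalf) p  ≡⟨ nth-balancedOf-upper m upperHalf (subst (p <_) (sym length-upperHalf) p<n) ⟩
      m + nth upperHalf p              ≡⟨ cong (m +_) (nth-applyUpTo _ p<n) ⟩
      m + (nth L p ∸ m)                ≡⟨ m+[n∸m]≡n (upper≥ (complement-index p<n)) ⟩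
      nth L p                          ∎)
      where open ≡-Reasoning
    ... | lower {j} {k} jk = begin
      nth L (n + k)
        ≡⟨ lower≡ jk ⟩
      m ∸ (nth L j ∸ m)
        ≡⟨ cong (m ∸_) (nth-applyUpTo _ (lower-index< jk)) ⟨
      m ∸ nth upperHalf j
        ≡⟨ nth-balancedOf-lower m upperHalf (trans jk (sym length-upperHalf)) ⟨
      nth (balancedOf m upperHalf) (length upperHalf + k)
        ≡⟨ cong (λ l → nth (balancedOf m upperHalf) (l + k)) length-upperHalf ⟩
      nth (balancedOf m upperHalf) (n + k)  ∎
      where open ≡-Reasoning

lookup≡nth : ∀ {n} (v : Vec ℕ n) i → lookup v i ≡ nth (toList v) (toℕ i)
lookup≡nth (x ∷ v) Fin.zero    = refl
lookup≡nth (x ∷ v) (Fin.suc i) = lookup≡nth v i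

vecOf : ∀ {A : Set} {n} (xs : List A) → length xs ≡ n → Vec A n
vecOf xs refl = fromList xs

toList-vecOf : ∀ {A : Set} {n} (xs : List A) (eq : length xs ≡ n) → toList (vecOf xs eq) ≡ xs
toList-vecOf xs refl = toList∘fromList xs

mirror-index : ∀ {j k n} → j + suc k ≡ n → 2 * n ∸ suc j ≡ n + k
mirror-index {j} {k} refl = trans (cong (_∸ suc j) (double j k)) (m+n∸m≡n (suc j) _)
  where
  double : ∀ j k → 2 * (j + suc k) ≡ suc j + ((j + suc k) + k)
  double = solve-∀

opposite-lower : ∀ {n j k} (i : Fin (2 * n)) → toℕ i ≡ j → j + suc k ≡ n → toℕ (opposite i) ≡ n + k
opposite-lower {n} i refl jk = trans (opposite-prop i) (mirror-index jk)

Balanced⇒IsBalanced : ∀ {n m} (w : Vec ℕ (2 * n)) → Balanced n m w → IsBalanced n m (toList w)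
Balanced⇒IsBalanced {n} {m} w (mono , _ , compl) = record
  { length≡       = length-toList w
  ; decreasing    = λ p≤q q<2n → subst₂ _≤_ (at q<2n) (at (≤-<-trans p≤q q<2n))
                                   (mono _ _ (subst₂ _≤_ (sym (toℕ-fromℕ< _)) (sym (toℕ-fromℕ< q<2n)) p≤q))
  ; complementary = complementary
  }
  where
  at : ∀ {p} (p< : p < 2 * n) → lookup w (fromℕ< p<) ≡ nth (toList w) p
  at p< = trans (lookup≡nth w _) (cong (nth (toList w)) (toℕ-fromℕ< p<))
  complementary : ∀ {j k} → j + suc k ≡ n → nth (toList w) j + nth (toList w) (n + k) ≡ 2 * m
  complementary {j} {k} jk =
    trans (sym (cong₂ _+_ (at j<2n) opposite≡)) (compl i (subst (_< n) (sym (toℕ-fromℕ< j<2n)) (lower-index< jk)))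
    where
    j<2n = ≤-trans (lower-index< jk) (m≤m+n n _)
    i = fromℕ< j<2n
    opposite≡ : lookup w (opposite i) ≡ nth (toList w) (n + k)
    opposite≡ = trans (lookup≡nth w (opposite i)) (cong (nth (toList w)) (opposite-lower i (toℕ-fromℕ< j<2n) jk))

IsBalanced⇒Balanced : ∀ {n m L} (bal : IsBalanced n m L) → sum L ≡ 2 * n * m →
                      Balanced n m (vecOf L (IsBalanced.length≡ bal))
IsBalanced⇒Balanced {n} {m} {L} bal sum≡ =
    (λ i j i≤j → subst₂ _≤_ (sym (at j)) (sym (at i)) (decreasing i≤j (toℕ<n j)))
  , trans (cong sum (toList-vecOf L length≡)) sum≡
  , λ i i<n → trans (cong₂ _+_ (at i) (trans (at (opposite i)) (cong (nth L) (opposite-lower i refl (complement-index i<n)))))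
                    (complementary (complement-index i<n))
  where
  open IsBalanced bal
  at : ∀ i → lookup (vecOf L length≡) i ≡ nth L (toℕ i)
  at i = trans (lookup≡nth (vecOf L length≡) i) (cong (λ xs → nth xs (toℕ i)) (toList-vecOf L length≡))

∣∣≡trues : ∀ {ℓ} (I : Subset ℓ) → ∣ I ∣ ≡ trues (toList I)
∣∣≡trues []          = refl
∣∣≡trues (true ∷ I)  = cong suc (∣∣≡trues I)
∣∣≡trues (false ∷ I) = ∣∣≡trues I

addNodes≡rows : ∀ ℓ (I : Subset ℓ) → toList (addNodes ℓ I) ≡ rows (toList I)
addNodes≡rows zero    []      = refl
addNodes≡rows (suc ℓ) (b ∷ I) = cong₂ _∷_ top-row (addNodes≡rows ℓ I)
  where
  top-row : 3 * ℓ + 1 + bit b ≡ suc (3 * length (toList I) + bit b)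
  top-row = trans (+-assoc (3 * ℓ) 1 (bit b))
                  (trans (+-suc (3 * ℓ) (bit b)) (cong (λ l → suc (3 * l + bit b)) (sym (length-toList I))))

balancedOf-InW : ∀ {n m d λs} → Descending m d → length d ≡ n → strip (balancedOf m d) ≡ strip λs → InW n m λs
balancedOf-InW {m = m} {d} ds refl e =
    vecOf (balancedOf m d) (IsBalanced.length≡ bal)
  , IsBalanced⇒Balanced bal (sum-balancedOf ds)
  , trans (cong strip (toList-vecOf (balancedOf m d) (IsBalanced.length≡ bal))) e
  where bal = balancedOf-isBalanced ds

path-InW : ∀ {m λs} x → trues x ≡ m → strip (bquot1 (rows x)) ≡ strip λs → InW (length x ∸ m) m λs
path-InW {λs = λs} x refl e =
  balancedOf-InW {λs = λs} (truesAfter-descending x ≤-refl) falses≡ (trans (sym (strip-bquot1-rows x)) e)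
  where
  falses≡ : length (truesAfter x) ≡ length x ∸ trues x
  falses≡ = trans (length-truesAfter x)
                  (sym (trans (cong (_∸ trues x) (length≡trues+falses x)) (m+n∸m≡n (trues x) (falses x))))

path-InF : ∀ {ℓ m λs} x → length x ≡ ℓ → trues x ≡ m → strip (bquot1 (rows x)) ≡ strip λs → InF ℓ m λs
path-InF x refl refl e =
    fromList x
  , trans (∣∣≡trues (fromList x)) (cong trues (toList∘fromList x))
  , trans (cong (strip ∘ bquot1) (trans (addNodes≡rows _ (fromList x)) (cong rows (toList∘fromList x)))) e

InF⇒InW : ∀ {ℓ m λs} → InF ℓ m λs → InW (ℓ ∸ m) m λs
InF⇒InW {m = m} {λs} (I , size , e) =
  subst (λ ℓ → InW (ℓ ∸ m) m λs) (length-toList I)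
        (path-InW {λs = λs} (toList I) (trans (sym (∣∣≡trues I)) size)
                  (trans (cong (strip ∘ bquot1) (sym (addNodes≡rows _ I))) e))

InW⇒InF : ∀ {ℓ m λs} → m ≤ ℓ → InW (ℓ ∸ m) m λs → InF ℓ m λs
InW⇒InF {ℓ} {m} {λs} m≤ℓ (w , balanced , e) = path-InF {λs = λs} (pathOf m d) length≡ℓ (trues-pathOf ds) strip≡
  where
  bal = Balanced⇒IsBalanced w balanced
  d   = upperHalf bal
  ds  = upperHalf-descending bal
  length≡ℓ : length (pathOf m d) ≡ ℓ
  length≡ℓ = begin
    length (pathOf m d)                          ≡⟨ length≡trues+falses (pathOf m d) ⟩
    trues (pathOf m d) + falses (pathOf m d)     ≡⟨ cong₂ _+_ (trues-pathOf ds) (falses-pathOf m d) ⟩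
    m + length d                                 ≡⟨ cong (m +_) (length-upperHalf bal) ⟩
    m + (ℓ ∸ m)                                  ≡⟨ m+[n∸m]≡n m≤ℓ ⟩
    ℓ                                            ∎
    where open ≡-Reasoning
  strip≡ : strip (bquot1 (rows (pathOf m d))) ≡ strip λs
  strip≡ = begin
    strip (bquot1 (rows (pathOf m d)))
      ≡⟨ strip-bquot1-rows (pathOf m d) ⟩
    strip (balancedOf (trues (pathOf m d)) (truesAfter (pathOf m d)))
      ≡⟨ cong₂ (λ t a → strip (balancedOf t a)) (trues-pathOf ds) (truesAfter-pathOf ds) ⟩
    strip (balancedOf m d)
      ≡⟨ cong strip (IsBalanced⇒balancedOf bal) ⟨
    strip (toList w)
      ≡⟨ e ⟩
    strip λs  ∎
    where open ≡-Reasoning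

lemma6p5 : (ℓ m : ℕ) → 1 ≤ ℓ → m ≤ ℓ →
    (λs : List ℕ) → (InW (ℓ ∸ m) m λs → InF ℓ m λs) × (InF ℓ m λs → InW (ℓ ∸ m) m λs)
lemma6p5 ℓ m _ m≤ℓ λs = InW⇒InF {λs = λs} m≤ℓ , InF⇒InW {λs = λs}
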